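{- Fix $s\in\mathbb{Z}_{\geqslant1}$ and an element $\alpha\in\mathbb{F}_{q^s}$ of degree $s$ over $\mathbb{F}_q$. Fix $k\in\mathbb{Z}_{\geqslant1}$ and put $r=1+sk$. Then for any $n\in\mathbb{Z}_{\geqslant1}$, $F_{q,n}\equiv0\pmod{T^q-T-\alpha}$ if and only if $F_{q^r,n}\equiv0\pmod{T^{q^r}-T-\alpha}$. In particular, for a fixed $\chi\in\mathbb{F}_q^{\times}$, $\alpha\in B_{q^r,s,\chi}$ if and only if $\alpha\in B_{q,s,\chi}$.
   Context: $q$ is a power of the prime $p$. For a prime power $Q$ and $i\geqslant1$ set $[i]_Q=T^{Q^i}-T$, $F_{Q,0}=1$ and $F_{Q,i}=(-1)^i+[i]_QF_{Q,i-1}$. For a prime power $Q$ (a power of $p$), $s\geqslant1$ and $\chi\in\mathbb{F}_Q$, the statement "$\alpha\in B_{Q,s,\chi}$" means: $\alpha\in\mathbb{F}_{Q^s}$ has degree $s$ over $\mathbb{F}_Q$, $\mathrm{Tr}_{\mathbb{F}_{Q^s}/\mathbb{F}_Q}(\alpha)=\chi$, and $F_{Q,ps-1}\equiv0\pmod{T^Q-T-\alpha}$ in $\mathbb{F}_{Q^s}[T]$. (Here $\alpha\in\mathbb{F}_{q^s}\subseteq\mathbb{F}_{q^{rs}}$.) -}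

module Defs where

open import Level using (Level; _⊔_)
open import Algebra.Bundles using (CommutativeRing)
open import Data.Nat as ℕ using (ℕ; zero; suc; _<_; _≤_)
open import Data.Nat.Primality using (Prime)
open import Data.Fin using (Fin)
open import Data.List using (List; []; _∷_)
open import Data.Product using (Σ; _×_; ∃; ∃-syntax)
open import Relation.Nullary using (¬_)
open import Relation.Binary.PropositionalEquality using (_≡_)

record Field (c ℓ : Level) : Set (Level.suc (c ⊔ ℓ)) where
  field
    commRing : CommutativeRing c ℓ
  open CommutativeRing commRing public
  field
    1≉0     : ¬ (1# ≈ 0#)
    inverse : ∀ x → ¬ (x ≈ 0#) → ∃[ y ] (x * y ≈ 1#)

HasSize : ∀ {c ℓ} → Field c ℓ → ℕ → Set (c ⊔ ℓ)
HasSize K N = let open Field K in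
  Σ (Fin N → Carrier) λ f →
    (∀ x → ∃[ i ] (f i ≈ x)) × (∀ i j → f i ≈ f j → i ≡ j)

IsPowerOf : ℕ → ℕ → Set
IsPowerOf q p = ∃[ e ] (1 ≤ e × q ≡ p ℕ.^ e)

module FieldTheory {c ℓ} (K : Field c ℓ) where
  open Field K public

  infixr 8 _^ᶠ_
  _^ᶠ_ : Carrier → ℕ → Carrier
  x ^ᶠ zero  = 1#
  x ^ᶠ suc n = x * (x ^ᶠ n)

  -- x lies in the subfield F_Q of K, i.e. x^Q = x
  InF : ℕ → Carrier → Set ℓ
  InF Q x = x ^ᶠ Q ≈ x

  -- α has degree exactly s over F_Q (Frobenius orbit of α under x ↦ x^Q has size s)
  DegreeOver : ℕ → ℕ → Carrier → Set ℓ
  DegreeOver Q s α = (1 ≤ s) × InF (Q ℕ.^ s) α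
                   × (∀ j → 1 ≤ j → j < s → ¬ InF (Q ℕ.^ j) α)

  trace : ℕ → ℕ → Carrier → Carrier
  trace Q zero    α = 0#
  trace Q (suc s) α = trace Q s α + α ^ᶠ (Q ℕ.^ s)

  -- Polynomials in T over K: coefficient lists, lowest degree first.
  Poly : Set c
  Poly = List Carrier

  coeff : Poly → ℕ → Carrier
  coeff []       _       = 0#
  coeff (a ∷ f)  zero    = a
  coeff (a ∷ f)  (suc i) = coeff f i

  _≈ₚ_ : Poly → Poly → Set ℓ
  f ≈ₚ g = ∀ i → coeff f i ≈ coeff g i

  _+ₚ_ : Poly → Poly → Poly
  []      +ₚ g       = g
  (a ∷ f) +ₚ []      = a ∷ f
  (a ∷ f) +ₚ (b ∷ g) = (a + b) ∷ (f +ₚ g)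

  scale : Carrier → Poly → Poly
  scale a []      = []
  scale a (b ∷ f) = (a * b) ∷ scale a f

  _*ₚ_ : Poly → Poly → Poly
  []      *ₚ g = []
  (a ∷ f) *ₚ g = scale a g +ₚ (0# ∷ (f *ₚ g))

  negₚ : Poly → Poly
  negₚ = scale (- 1#)

  _-ₚ_ : Poly → Poly → Poly
  f -ₚ g = f +ₚ negₚ g

  const : Carrier → Poly
  const a = a ∷ []

  Tpow : ℕ → Poly
  Tpow zero    = 1# ∷ []
  Tpow (suc n) = 0# ∷ Tpow n

  T : Poly
  T = Tpow 1

  bracket : ℕ → ℕ → Poly
  bracket Q i = Tpow (Q ℕ.^ i) -ₚ T

  sign : ℕ → Carrier
  sign zero    = 1#
  sign (suc i) = - (sign i)

  Fpoly : ℕ → ℕ → Poly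
  Fpoly Q zero    = const 1#
  Fpoly Q (suc i) = const (sign (suc i)) +ₚ (bracket Q (suc i) *ₚ Fpoly Q i)

  _≡0mod_ : Poly → Poly → Set (c ⊔ ℓ)
  f ≡0mod m = ∃[ g ] (f ≈ₚ (g *ₚ m))

  modulus : ℕ → Carrier → Poly
  modulus Q α = (Tpow Q -ₚ T) -ₚ const α

  -- α ∈ B_{Q,s,χ}  (p the characteristic)
  InB : ℕ → ℕ → ℕ → Carrier → Carrier → Set (c ⊔ ℓ)
  InB p Q s χ α = InF (Q ℕ.^ s) α × DegreeOver Q s α × (trace Q s α ≈ χ)
                × (Fpoly Q (p ℕ.* s ℕ.∸ 1) ≡0mod modulus Q α)

{-# OPTIONS --safe #-}
-- Modulo M = T^Q − T − α, with Q a power of the characteristic p, the map x ↦ x^Q is additive, so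
-- T^{Q^i} ≡ (T + α)^{Q^{i−1}} ≡ T + Tr_i(α), where Tr_i(α) = α + α^Q + ⋯ + α^{Q^{i−1}}. Hence
-- [i]_Q ≡ Tr_i(α), and F_{Q,n} is congruent to the constant obtained by running its recursion with
-- Tr_i(α) in place of [i]_Q; as deg M = Q ≥ 2, M divides F_{Q,n} iff this constant is 0.
-- For α ∈ F_{Q^s} and Q′ = Q^{1+sk} we have α^{Q′^i} = α^{Q^i}, so the traces, hence the constants,
-- agree for Q and Q′, and so does every other condition defining B_{Q,s,χ}.
module Submission where

open import Defs
open import Algebra.Bundles using (CommutativeSemigroup; CommutativeSemiring; CommutativeRing)
import Algebra.Properties.Semiring.Mult as Mult
open import Data.Fin using (Fin; zero; suc; toℕ; inject₁; fromℕ)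
open import Data.Fin.Properties using (toℕ-fromℕ; toℕ-inject₁; toℕ<n)
open import Data.Nat as ℕ using (ℕ; zero; suc; _<_; _≤_; _∸_; _!; z≤n; s≤s; nonTrivial⇒n>1)
import Data.Nat.Properties as ℕ
open import Data.Nat.Combinatorics using (_C_; nCn≡1; nCk≡n!/k![n-k]!; k![n∸k]!∣n!)
open import Data.Nat.DivMod using (m*[n/m]≡n)
open import Data.Nat.Divisibility using (_∣_; _∤_; divides; ∣⇒≤; m∣m*n)
open import Data.Nat.Primality using (Prime; euclidsLemma; prime⇒nonTrivial; prime⇒nonZero)
open import Data.Nat.Tactic.RingSolver using (solve-∀)
open import Data.Product using (_,_)
open import Data.Sum using (inj₁; inj₂)
open import Function using (_∘_)
open import Function.Construct.Symmetry using (⇔-sym)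
open import Relation.Binary.PropositionalEquality as ≡ using (_≡_)
open import Relation.Nullary using (contradiction)

prime⇒>1 : ∀ {p} → Prime p → 1 < p
prime⇒>1 {p} pr = nonTrivial⇒n>1 p {{prime⇒nonTrivial pr}}

p∤n! : ∀ {p n} → Prime p → n < p → p ∤ n !
p∤n! {n = zero}  pr _ p∣1 = ℕ.<⇒≱ (prime⇒>1 pr) (∣⇒≤ p∣1)
p∤n! {n = suc n} pr n<p p∣n! with euclidsLemma (suc n) (n !) pr p∣n!
... | inj₁ p∣1+n = ℕ.<⇒≱ n<p (∣⇒≤ p∣1+n)
... | inj₂ p∣n!  = p∤n! pr (ℕ.<-trans (ℕ.n<1+n n) n<p) p∣n!

k![n∸k]!*nCk≡n! : ∀ {n k} → k ≤ n → k ! ℕ.* (n ∸ k) ! ℕ.* (n C k) ≡ n !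
k![n∸k]!*nCk≡n! {n} {k} k≤n = ≡.trans (≡.cong (k ! ℕ.* (n ∸ k) ! ℕ.*_) (nCk≡n!/k![n-k]! k≤n))
                                       (m*[n/m]≡n (k![n∸k]!∣n! k≤n))
  where
  instance
    k![n∸k]!≢0 : ℕ.NonZero (k ! ℕ.* (n ∸ k) !)
    k![n∸k]!≢0 = ℕ._!*_!≢0 k (n ∸ k)

p∣pCk : ∀ {p k} → Prime p → 0 < k → k < p → p ∣ p C k
p∣pCk {suc m} {k} pr 0<k k<p
  with euclidsLemma (k ! ℕ.* (suc m ∸ k) !) (suc m C k) pr
         (≡.subst (suc m ∣_) (≡.sym (k![n∸k]!*nCk≡n! (ℕ.<⇒≤ k<p))) (m∣m*n (m !)))
... | inj₂ p∣pCk = p∣pCk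
... | inj₁ p∣k![p∸k]! with euclidsLemma (k !) ((suc m ∸ k) !) pr p∣k![p∸k]!
...   | inj₁ p∣k!     = contradiction p∣k! (p∤n! pr k<p)
...   | inj₂ p∣[p∸k]! = contradiction p∣[p∸k]! (p∤n! pr (ℕ.∸-monoʳ-< 0<k (ℕ.<⇒≤ k<p)))

IsPowerOf⇒>1 : ∀ {p Q} → Prime p → IsPowerOf Q p → 1 < Q
IsPowerOf⇒>1 {p} pr (e , 1≤e , ≡.refl) = ℕ.<-≤-trans (prime⇒>1 pr)
  (ℕ.≤-trans (ℕ.≤-reflexive (≡.sym (ℕ.*-identityʳ p))) (ℕ.^-monoʳ-≤ p {{prime⇒nonZero pr}} 1≤e))

IsPowerOf-^ : ∀ {p Q m} → IsPowerOf Q p → 1 ≤ m → IsPowerOf (Q ℕ.^ m) p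
IsPowerOf-^ {p} {m = m} (e , 1≤e , ≡.refl) 1≤m = e ℕ.* m , ℕ.*-mono-≤ 1≤e 1≤m , ℕ.^-*-assoc p e m

1+t+i≤t+[1+j+i] : ∀ t i j → suc t ℕ.+ i ≤ t ℕ.+ (suc j ℕ.+ i)
1+t+i≤t+[1+j+i] t i j = ℕ.≤-trans (ℕ.≤-reflexive (≡.sym (ℕ.+-suc t i)))
                                  (ℕ.+-monoʳ-≤ t (s≤s (ℕ.m≤n+m i j)))

[1+sk]i≡s[ki]+i : ∀ s k i → (1 ℕ.+ s ℕ.* k) ℕ.* i ≡ s ℕ.* (k ℕ.* i) ℕ.+ i
[1+sk]i≡s[ki]+i = solve-∀

[Q^[1+sk]]^i≡[Q^s]^[ki]*Q^i : ∀ Q s k i → (Q ℕ.^ (1 ℕ.+ s ℕ.* k)) ℕ.^ i ≡ (Q ℕ.^ s) ℕ.^ (k ℕ.* i) ℕ.* Q ℕ.^ i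
[Q^[1+sk]]^i≡[Q^s]^[ki]*Q^i Q s k i = begin
  (Q ℕ.^ (1 ℕ.+ s ℕ.* k)) ℕ.^ i       ≡⟨ ℕ.^-*-assoc Q (1 ℕ.+ s ℕ.* k) i ⟩
  Q ℕ.^ ((1 ℕ.+ s ℕ.* k) ℕ.* i)       ≡⟨ ≡.cong (Q ℕ.^_) ([1+sk]i≡s[ki]+i s k i) ⟩
  Q ℕ.^ (s ℕ.* (k ℕ.* i) ℕ.+ i)       ≡⟨ ℕ.^-distribˡ-+-* Q (s ℕ.* (k ℕ.* i)) i ⟩
  Q ℕ.^ (s ℕ.* (k ℕ.* i)) ℕ.* Q ℕ.^ i ≡⟨ ≡.cong (ℕ._* Q ℕ.^ i) (ℕ.^-*-assoc Q s (k ℕ.* i)) ⟨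
  (Q ℕ.^ s) ℕ.^ (k ℕ.* i) ℕ.* Q ℕ.^ i ∎
  where open ≡.≡-Reasoning

HasCharacteristic : ∀ {c ℓ} → Field c ℓ → ℕ → Set ℓ
HasCharacteristic K p = Mult._×_ semiring p 1# ≈ 0#
  where open Field K

module Frobenius {a ℓ} (S : CommutativeSemiring a ℓ) where
  open CommutativeSemiring S hiding (zero)
  open import Algebra.Properties.Semiring.Mult semiring
  open import Algebra.Properties.Semiring.Exp semiring
  open import Algebra.Properties.Semiring.Sum semiring using (sum; sum-init-last; sum-cong-≋; sum-replicate-zero)
  open import Algebra.Properties.CommutativeSemiring.Binomial S using (theorem; binomialTerm)
  open import Data.Vec.Functional using (Vector; init; replicate)
  open import Relation.Binary.Reasoning.Setoid setoid

  p×≈0 : ∀ {p} → p × 1# ≈ 0# → ∀ x → p × x ≈ 0#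
  p×≈0 {p} p×1≈0 x = begin
    p × x          ≈⟨ ×-congʳ p (*-identityˡ x) ⟨
    p × (1# * x)   ≈⟨ ×-assoc-* p 1# x ⟨
    (p × 1#) * x   ≈⟨ *-congʳ p×1≈0 ⟩
    0# * x         ≈⟨ zeroˡ x ⟩
    0#             ∎

  ∣⇒×≈0 : ∀ {p n} → p × 1# ≈ 0# → p ∣ n → ∀ x → n × x ≈ 0#
  ∣⇒×≈0 {p} p×1≈0 (divides d ≡.refl) x = begin
    (d ℕ.* p) × x  ≈⟨ ×-congˡ (ℕ.*-comm d p) ⟩
    (p ℕ.* d) × x  ≈⟨ ×-assocˡ x p d ⟨
    p × (d × x)    ≈⟨ p×≈0 {p} p×1≈0 (d × x) ⟩
    0#             ∎

  sum≈last : ∀ {n} (t : Vector Carrier (suc n)) → (∀ i → t (inject₁ i) ≈ 0#) → sum t ≈ t (fromℕ n)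
  sum≈last {n} t init≈0 = begin
    sum t                            ≈⟨ sum-init-last t ⟩
    sum (init t) + t (fromℕ n)       ≈⟨ +-congʳ (sum-cong-≋ init≈0) ⟩
    sum (replicate n 0#) + t (fromℕ n) ≈⟨ +-congʳ (sum-replicate-zero n) ⟩
    0# + t (fromℕ n)                 ≈⟨ +-identityˡ _ ⟩
    t (fromℕ n)                      ∎

  ^p-distrib-+ : ∀ {p} → Prime p → p × 1# ≈ 0# → ∀ x y → (x + y) ^ p ≈ x ^ p + y ^ p
  ^p-distrib-+ {suc (suc m)} pr p×1≈0 x y = begin
    (x + y) ^ p                          ≈⟨ theorem p x y ⟩
    term zero + sum (λ k → term (suc k)) ≈⟨ +-congˡ (sum≈last (λ k → term (suc k)) middle≈0) ⟩
    term zero + term (fromℕ p)           ≈⟨ +-cong first last ⟩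
    y ^ p + x ^ p                        ≈⟨ +-comm _ _ ⟩
    x ^ p + y ^ p                        ∎
    where
    p : ℕ
    p = suc (suc m)
    term : Fin (suc p) → Carrier
    term = binomialTerm x y p
    first : term zero ≈ y ^ p
    first = trans (×-homo-1 _) (*-identityˡ _)
    last : term (fromℕ p) ≈ x ^ p
    last = top (fromℕ p) (toℕ-fromℕ p)
      where
      top : ∀ k → toℕ k ≡ p → term k ≈ x ^ p
      top k eq rewrite eq | nCn≡1 p | ℕ.n∸n≡0 m = trans (×-homo-1 _) (*-identityʳ _)
    middle≈0 : ∀ (j : Fin (suc m)) → term (suc (inject₁ j)) ≈ 0#
    middle≈0 j = ∣⇒×≈0 p×1≈0 (p∣pCk pr (s≤s z≤n) j+1<p) _
      where
      j+1<p : suc (toℕ (inject₁ j)) < p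
      j+1<p rewrite toℕ-inject₁ j = s≤s (toℕ<n j)

  ^p^n-distrib-+ : ∀ {p} → Prime p → p × 1# ≈ 0# →
                   ∀ n x y → (x + y) ^ (p ℕ.^ n) ≈ x ^ (p ℕ.^ n) + y ^ (p ℕ.^ n)
  ^p^n-distrib-+ pr p×1≈0 zero x y = distribʳ 1# x y
  ^p^n-distrib-+ {p} pr p×1≈0 (suc n) x y = begin
    (x + y) ^ (p ℕ.* p ℕ.^ n)                   ≈⟨ ^-assocʳ (x + y) p (p ℕ.^ n) ⟨
    ((x + y) ^ p) ^ (p ℕ.^ n)                   ≈⟨ ^-congˡ (p ℕ.^ n) (^p-distrib-+ pr p×1≈0 x y) ⟩
    (x ^ p + y ^ p) ^ (p ℕ.^ n)                 ≈⟨ ^p^n-distrib-+ pr p×1≈0 n (x ^ p) (y ^ p) ⟩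
    (x ^ p) ^ (p ℕ.^ n) + (y ^ p) ^ (p ℕ.^ n)   ≈⟨ +-cong (^-assocʳ x p (p ℕ.^ n)) (^-assocʳ y p (p ℕ.^ n)) ⟩
    x ^ (p ℕ.* p ℕ.^ n) + y ^ (p ℕ.* p ℕ.^ n)   ∎

module FiniteField {c ℓ} (K : Field c ℓ) {N} (finite : HasSize K N) where
  open FieldTheory K hiding (zero)
  open import Algebra.Properties.Semiring.Mult semiring using (_×_; ×1-homo-*)
  open import Algebra.Properties.Semiring.Exp semiring using (_^_)
  open import Algebra.Properties.CommutativeMonoid.Sum +-commutativeMonoid
    using (sum; sum-permute; sum-cong-≋; ∑-distrib-+; sum-replicate)
  open import Algebra.Properties.Group +-group using (identityʳ-unique)
  open import Data.Fin.Permutation using (Permutation′; permutation)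
  open import Data.Fin.Properties as Fin using ()
  open import Data.Product using (_,_; proj₁; proj₂)
  open import Data.Empty using (⊥-elim)
  open import Relation.Nullary using (Dec; yes; no)
  open import Relation.Binary.Reasoning.Setoid setoid

  private
    element : Fin N → Carrier
    element = proj₁ finite

    index : Carrier → Fin N
    index x = proj₁ (proj₁ (proj₂ finite) x)

    element-index : ∀ x → element (index x) ≈ x
    element-index x = proj₂ (proj₁ (proj₂ finite) x)

    element-injective : ∀ {i j} → element i ≈ element j → i ≡ j
    element-injective = proj₂ (proj₂ finite) _ _

  _≟_ : ∀ x y → Dec (x ≈ y)
  x ≟ y with index x Fin.≟ index y
  ... | yes i≡j = yes (begin
    x                 ≈⟨ element-index x ⟨
    element (index x) ≡⟨ ≡.cong element i≡j ⟩
    element (index y) ≈⟨ element-index y ⟩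
    y                 ∎)
  ... | no i≢j = no λ x≈y → i≢j (element-injective
                   (trans (element-index x) (trans x≈y (sym (element-index y)))))

  private
    translate : Carrier → Fin N → Fin N
    translate a i = index (element i + a)

    translate-inverse : ∀ {a b} → b + a ≈ 0# → ∀ i → translate a (translate b i) ≡ i
    translate-inverse {a} {b} b+a≈0 i = element-injective (begin
      element (translate a (translate b i)) ≈⟨ element-index _ ⟩
      element (translate b i) + a           ≈⟨ +-congʳ (element-index _) ⟩
      element i + b + a                     ≈⟨ +-assoc _ _ _ ⟩
      element i + (b + a)                   ≈⟨ +-congˡ b+a≈0 ⟩
      element i + 0#                        ≈⟨ +-identityʳ _ ⟩
      element i                             ∎)

  -- Translation by 1 permutes K, so adding 1 to every element leaves the sum of all elements unchanged.
  N×1≈0 : N × 1# ≈ 0#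
  N×1≈0 = identityʳ-unique (sum element) (N × 1#) (sym (begin
    sum element                                  ≈⟨ sum-permute element translation ⟩
    sum (λ i → element (translate 1# i))         ≈⟨ sum-cong-≋ {N} (λ i → element-index _) ⟩
    sum (λ i → element i + 1#)                   ≈⟨ ∑-distrib-+ element (λ _ → 1#) ⟩
    sum element + sum {N} (λ _ → 1#)             ≈⟨ +-congˡ (sum-replicate N) ⟩
    sum element + N × 1#                         ∎))
    where
    translation : Permutation′ N
    translation = permutation (translate 1#) (translate (- 1#))
                    (translate-inverse (-‿inverseˡ 1#)) (translate-inverse (-‿inverseʳ 1#))

  -- Constructively this needs the decidable equality that finiteness provides.
  ^≈0⇒≈0 : ∀ x n → x ^ n ≈ 0# → x ≈ 0#
  ^≈0⇒≈0 x zero    1≈0    = ⊥-elim (1≉0 1≈0)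
  ^≈0⇒≈0 x (suc n) xⁿ⁺¹≈0 with x ≟ 0#
  ... | yes x≈0 = x≈0
  ... | no  x≉0 with inverse x x≉0
  ...   | y , xy≈1 = ^≈0⇒≈0 x n (begin
    x ^ n              ≈⟨ *-identityʳ _ ⟨
    x ^ n * 1#         ≈⟨ *-congˡ xy≈1 ⟨
    x ^ n * (x * y)    ≈⟨ *-assoc _ _ _ ⟨
    x ^ n * x * y      ≈⟨ *-congʳ (*-comm _ _) ⟩
    x * x ^ n * y      ≈⟨ *-congʳ xⁿ⁺¹≈0 ⟩
    0# * y             ≈⟨ zeroˡ y ⟩
    0#                 ∎)

  ^×1≈×1^ : ∀ p n → (p ℕ.^ n) × 1# ≈ (p × 1#) ^ n
  ^×1≈×1^ p zero    = +-identityʳ 1#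
  ^×1≈×1^ p (suc n) = trans (×1-homo-* p (p ℕ.^ n)) (*-congˡ (^×1≈×1^ p n))

  IsPowerOf⇒p×1≈0 : ∀ {p} → IsPowerOf N p → HasCharacteristic K p
  IsPowerOf⇒p×1≈0 {p} (e , _ , ≡.refl) = ^≈0⇒≈0 (p × 1#) e (trans (sym (^×1≈×1^ p e)) N×1≈0)

module PolynomialRing {c ℓ} (K : Field c ℓ) where
  open import Algebra.Structures using (IsCommutativeSemigroup)
  open import Relation.Binary.Structures using (IsEquivalence)
  open import Data.List using (List; []; _∷_; length)
  open FieldTheory K hiding (zero)
  open import Algebra.Properties.Ring ring using (-1*x≈-x)
  open import Data.Product using (_,_)
  open import Relation.Binary.Reasoning.Setoid setoid

  -- A record, so that f and g can be recovered from f ≋ g by unification.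
  infix 4 _≋_
  record _≋_ (f g : Poly) : Set ℓ where
    constructor mk≋
    field coeff-≈ : f ≈ₚ g
  open _≋_ public

  ≋-refl : ∀ {f} → f ≋ f
  ≋-refl = mk≋ λ i → refl

  ≋-sym : ∀ {f g} → f ≋ g → g ≋ f
  ≋-sym (mk≋ f≈g) = mk≋ λ i → sym (f≈g i)

  ≋-trans : ∀ {f g h} → f ≋ g → g ≋ h → f ≋ h
  ≋-trans (mk≋ f≈g) (mk≋ g≈h) = mk≋ λ i → trans (f≈g i) (g≈h i)

  coeff-+ₚ : ∀ f g i → coeff (f +ₚ g) i ≈ coeff f i + coeff g i
  coeff-+ₚ []      g       i       = sym (+-identityˡ _)
  coeff-+ₚ (a ∷ f) []      i       = sym (+-identityʳ _)
  coeff-+ₚ (a ∷ f) (b ∷ g) zero    = refl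
  coeff-+ₚ (a ∷ f) (b ∷ g) (suc i) = coeff-+ₚ f g i

  coeff-scale : ∀ a f i → coeff (scale a f) i ≈ a * coeff f i
  coeff-scale a []      i       = sym (zeroʳ a)
  coeff-scale a (b ∷ f) zero    = refl
  coeff-scale a (b ∷ f) (suc i) = coeff-scale a f i

  coeff-negₚ : ∀ f i → coeff (negₚ f) i ≈ - coeff f i
  coeff-negₚ f i = trans (coeff-scale (- 1#) f i) (-1*x≈-x _)

  ∷-cong : ∀ {a b f g} → a ≈ b → f ≋ g → a ∷ f ≋ b ∷ g
  ∷-cong a≈b (mk≋ f≈g) = mk≋ λ { zero → a≈b ; (suc i) → f≈g i }

  0∷≋[] : ∀ {f} → f ≋ [] → 0# ∷ f ≋ []
  0∷≋[] (mk≋ f≈[]) = mk≋ λ { zero → refl ; (suc i) → f≈[] i }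

  +ₚ-cong : ∀ {f f′ g g′} → f ≋ f′ → g ≋ g′ → f +ₚ g ≋ f′ +ₚ g′
  +ₚ-cong {f} {f′} {g} {g′} (mk≋ f≈f′) (mk≋ g≈g′) = mk≋ λ i → begin
    coeff (f +ₚ g) i          ≈⟨ coeff-+ₚ f g i ⟩
    coeff f i + coeff g i     ≈⟨ +-cong (f≈f′ i) (g≈g′ i) ⟩
    coeff f′ i + coeff g′ i   ≈⟨ coeff-+ₚ f′ g′ i ⟨
    coeff (f′ +ₚ g′) i        ∎

  scale-cong : ∀ {a b f g} → a ≈ b → f ≋ g → scale a f ≋ scale b g
  scale-cong {a} {b} {f} {g} a≈b (mk≋ f≈g) = mk≋ λ i → begin
    coeff (scale a f) i  ≈⟨ coeff-scale a f i ⟩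
    a * coeff f i        ≈⟨ *-cong a≈b (f≈g i) ⟩
    b * coeff g i        ≈⟨ coeff-scale b g i ⟨
    coeff (scale b g) i  ∎

  +ₚ-comm : ∀ f g → f +ₚ g ≋ g +ₚ f
  +ₚ-comm f g = mk≋ λ i → begin
    coeff (f +ₚ g) i       ≈⟨ coeff-+ₚ f g i ⟩
    coeff f i + coeff g i  ≈⟨ +-comm _ _ ⟩
    coeff g i + coeff f i  ≈⟨ coeff-+ₚ g f i ⟨
    coeff (g +ₚ f) i       ∎

  +ₚ-assoc : ∀ f g h → (f +ₚ g) +ₚ h ≋ f +ₚ (g +ₚ h)
  +ₚ-assoc f g h = mk≋ λ i → begin
    coeff ((f +ₚ g) +ₚ h) i                ≈⟨ coeff-+ₚ (f +ₚ g) h i ⟩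
    coeff (f +ₚ g) i + coeff h i           ≈⟨ +-congʳ (coeff-+ₚ f g i) ⟩
    (coeff f i + coeff g i) + coeff h i    ≈⟨ +-assoc _ _ _ ⟩
    coeff f i + (coeff g i + coeff h i)    ≈⟨ +-congˡ (coeff-+ₚ g h i) ⟨
    coeff f i + coeff (g +ₚ h) i           ≈⟨ coeff-+ₚ f (g +ₚ h) i ⟨
    coeff (f +ₚ (g +ₚ h)) i                ∎

  +ₚ-identityʳ : ∀ f → f +ₚ [] ≋ f
  +ₚ-identityʳ f = mk≋ λ i → trans (coeff-+ₚ f [] i) (+-identityʳ _)

  negₚ-inverseˡ : ∀ f → negₚ f +ₚ f ≋ []
  negₚ-inverseˡ f = mk≋ λ i → begin
    coeff (negₚ f +ₚ f) i        ≈⟨ coeff-+ₚ (negₚ f) f i ⟩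
    coeff (negₚ f) i + coeff f i ≈⟨ +-congʳ (coeff-negₚ f i) ⟩
    - coeff f i + coeff f i      ≈⟨ -‿inverseˡ _ ⟩
    0#                           ∎

  scale-distribˡ : ∀ a f g → scale a (f +ₚ g) ≋ scale a f +ₚ scale a g
  scale-distribˡ a f g = mk≋ λ i → begin
    coeff (scale a (f +ₚ g)) i                 ≈⟨ coeff-scale a (f +ₚ g) i ⟩
    a * coeff (f +ₚ g) i                       ≈⟨ *-congˡ (coeff-+ₚ f g i) ⟩
    a * (coeff f i + coeff g i)                ≈⟨ distribˡ _ _ _ ⟩
    a * coeff f i + a * coeff g i              ≈⟨ +-cong (coeff-scale a f i) (coeff-scale a g i) ⟨
    coeff (scale a f) i + coeff (scale a g) i  ≈⟨ coeff-+ₚ (scale a f) (scale a g) i ⟨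
    coeff (scale a f +ₚ scale a g) i           ∎

  scale-distribʳ : ∀ a b f → scale (a + b) f ≋ scale a f +ₚ scale b f
  scale-distribʳ a b f = mk≋ λ i → begin
    coeff (scale (a + b) f) i                  ≈⟨ coeff-scale (a + b) f i ⟩
    (a + b) * coeff f i                        ≈⟨ distribʳ _ _ _ ⟩
    a * coeff f i + b * coeff f i              ≈⟨ +-cong (coeff-scale a f i) (coeff-scale b f i) ⟨
    coeff (scale a f) i + coeff (scale b f) i  ≈⟨ coeff-+ₚ (scale a f) (scale b f) i ⟨
    coeff (scale a f +ₚ scale b f) i           ∎

  scale-scale : ∀ a b f → scale a (scale b f) ≋ scale (a * b) f
  scale-scale a b f = mk≋ λ i → begin
    coeff (scale a (scale b f)) i  ≈⟨ coeff-scale a (scale b f) i ⟩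
    a * coeff (scale b f) i        ≈⟨ *-congˡ (coeff-scale b f i) ⟩
    a * (b * coeff f i)            ≈⟨ *-assoc _ _ _ ⟨
    a * b * coeff f i              ≈⟨ coeff-scale (a * b) f i ⟨
    coeff (scale (a * b) f) i      ∎

  scale-zero : ∀ f → scale 0# f ≋ []
  scale-zero f = mk≋ λ i → trans (coeff-scale 0# f i) (zeroˡ _)

  scale-one : ∀ f → scale 1# f ≋ f
  scale-one f = mk≋ λ i → trans (coeff-scale 1# f i) (*-identityˡ _)

  ≋-isEquivalence : IsEquivalence _≋_
  ≋-isEquivalence = record { refl = ≋-refl ; sym = ≋-sym ; trans = ≋-trans }

  +ₚ-isCommutativeSemigroup : IsCommutativeSemigroup _≋_ _+ₚ_
  +ₚ-isCommutativeSemigroup = record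
    { isSemigroup = record
      { isMagma = record { isEquivalence = ≋-isEquivalence ; ∙-cong = +ₚ-cong }
      ; assoc   = +ₚ-assoc }
    ; comm = +ₚ-comm }

  +ₚ-commutativeSemigroup : CommutativeSemigroup c ℓ
  +ₚ-commutativeSemigroup = record { isCommutativeSemigroup = +ₚ-isCommutativeSemigroup }

  open import Algebra.Properties.CommutativeSemigroup +ₚ-commutativeSemigroup
    using (x∙yz≈y∙xz; interchange)

  *ₚ-zeroʳ : ∀ f → f *ₚ [] ≋ []
  *ₚ-zeroʳ []      = ≋-refl
  *ₚ-zeroʳ (a ∷ f) = 0∷≋[] (*ₚ-zeroʳ f)

  ≋[]⇒*ₚ≋[] : ∀ f g → f ≋ [] → f *ₚ g ≋ []
  ≋[]⇒*ₚ≋[] []      g _ = ≋-refl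
  ≋[]⇒*ₚ≋[] (a ∷ f) g (mk≋ a∷f≈[]) = mk≋ λ i → begin
    coeff (scale a g +ₚ (0# ∷ (f *ₚ g))) i           ≈⟨ coeff-+ₚ (scale a g) _ i ⟩
    coeff (scale a g) i + coeff (0# ∷ (f *ₚ g)) i    ≈⟨ +-cong (coeff-≈ (scale-cong {f = g} (a∷f≈[] 0) ≋-refl) i)
                                                              (coeff-≈ (0∷≋[] (≋[]⇒*ₚ≋[] f g (mk≋ (λ i → a∷f≈[] (suc i))))) i) ⟩
    coeff (scale 0# g) i + 0#                        ≈⟨ +-identityʳ _ ⟩
    coeff (scale 0# g) i                             ≈⟨ coeff-≈ (scale-zero g) i ⟩
    0#                                               ∎

  *ₚ-congˡ : ∀ {f f′} g → f ≋ f′ → f *ₚ g ≋ f′ *ₚ g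
  *ₚ-congˡ {[]}    {f′}     g f≋f′ = ≋-sym (≋[]⇒*ₚ≋[] f′ g (≋-sym f≋f′))
  *ₚ-congˡ {a ∷ f} {[]}     g f≋f′ = ≋[]⇒*ₚ≋[] (a ∷ f) g f≋f′
  *ₚ-congˡ {a ∷ f} {b ∷ f′} g (mk≋ a∷f≈b∷f′) =
    +ₚ-cong (scale-cong {f = g} (a∷f≈b∷f′ 0) ≋-refl)
            (∷-cong refl (*ₚ-congˡ {f} {f′} g (mk≋ λ i → a∷f≈b∷f′ (suc i))))

  *ₚ-congʳ : ∀ f {g g′} → g ≋ g′ → f *ₚ g ≋ f *ₚ g′
  *ₚ-congʳ []      g≋g′ = ≋-refl
  *ₚ-congʳ (a ∷ f) g≋g′ = +ₚ-cong (scale-cong refl g≋g′) (∷-cong refl (*ₚ-congʳ f g≋g′))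

  *ₚ-cong : ∀ {f f′ g g′} → f ≋ f′ → g ≋ g′ → f *ₚ g ≋ f′ *ₚ g′
  *ₚ-cong {f} {f′} {g} f≋f′ g≋g′ = ≋-trans (*ₚ-congˡ g f≋f′) (*ₚ-congʳ f′ g≋g′)

  0∷-*ₚ : ∀ f g → (0# ∷ f) *ₚ g ≋ 0# ∷ (f *ₚ g)
  0∷-*ₚ f g = +ₚ-cong (scale-zero g) ≋-refl

  *ₚ-∷ʳ : ∀ f b g → f *ₚ (b ∷ g) ≋ scale b f +ₚ (0# ∷ (f *ₚ g))
  *ₚ-∷ʳ []      b g = ≋-sym (0∷≋[] ≋-refl)
  *ₚ-∷ʳ (a ∷ f) b g = ∷-cong (trans (+-identityʳ _) (trans (*-comm a b) (sym (+-identityʳ _))))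
    (≋-trans (+ₚ-cong (≋-refl {scale a g}) (*ₚ-∷ʳ f b g))
             (x∙yz≈y∙xz (scale a g) (scale b f) (0# ∷ (f *ₚ g))))

  *ₚ-comm : ∀ f g → f *ₚ g ≋ g *ₚ f
  *ₚ-comm []      g = ≋-sym (*ₚ-zeroʳ g)
  *ₚ-comm (a ∷ f) g = ≋-trans (+ₚ-cong (≋-refl {scale a g}) (∷-cong refl (*ₚ-comm f g)))
                              (≋-sym (*ₚ-∷ʳ g a f))

  *ₚ-distribʳ : ∀ h f g → (f +ₚ g) *ₚ h ≋ (f *ₚ h) +ₚ (g *ₚ h)
  *ₚ-distribʳ h []      g       = ≋-refl
  *ₚ-distribʳ h (a ∷ f) []      = ≋-sym (+ₚ-identityʳ _)
  *ₚ-distribʳ h (a ∷ f) (b ∷ g) = ≋-trans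
    (+ₚ-cong (scale-distribʳ a b h)
             (∷-cong (sym (+-identityˡ 0#)) (*ₚ-distribʳ h f g)))
    (interchange (scale a h) (scale b h) (0# ∷ (f *ₚ h)) (0# ∷ (g *ₚ h)))

  scale-*ₚ : ∀ a f g → scale a f *ₚ g ≋ scale a (f *ₚ g)
  scale-*ₚ a []      g = ≋-refl
  scale-*ₚ a (b ∷ f) g = ≋-trans
    (+ₚ-cong (≋-sym (scale-scale a b g)) (∷-cong (sym (zeroʳ a)) (scale-*ₚ a f g)))
    (≋-sym (scale-distribˡ a (scale b g) (0# ∷ (f *ₚ g))))

  *ₚ-assoc : ∀ f g h → (f *ₚ g) *ₚ h ≋ f *ₚ (g *ₚ h)
  *ₚ-assoc []      g h = ≋-refl
  *ₚ-assoc (a ∷ f) g h = ≋-trans (*ₚ-distribʳ h (scale a g) (0# ∷ (f *ₚ g)))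
    (+ₚ-cong (scale-*ₚ a g h) (≋-trans (0∷-*ₚ (f *ₚ g) h) (∷-cong refl (*ₚ-assoc f g h))))

  *ₚ-identityˡ : ∀ f → const 1# *ₚ f ≋ f
  *ₚ-identityˡ f = ≋-trans (+ₚ-cong (scale-one f) (0∷≋[] ≋-refl)) (+ₚ-identityʳ f)

  K[T] : CommutativeRing c ℓ
  K[T] = record
    { Carrier = Poly ; _≈_ = _≋_ ; _+_ = _+ₚ_ ; _*_ = _*ₚ_ ; -_ = negₚ ; 0# = [] ; 1# = const 1#
    ; isCommutativeRing = record
      { isRing = record
        { +-isAbelianGroup = record
          { isGroup = record
            { isMonoid = record
              { isSemigroup = IsCommutativeSemigroup.isSemigroup +ₚ-isCommutativeSemigroup
              ; identity    = (λ f → ≋-refl) , +ₚ-identityʳ }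
            ; inverse = negₚ-inverseˡ , (λ f → ≋-trans (+ₚ-comm f (negₚ f)) (negₚ-inverseˡ f))
            ; ⁻¹-cong = scale-cong refl }
          ; comm = +ₚ-comm }
        ; *-cong     = *ₚ-cong
        ; *-assoc    = *ₚ-assoc
        ; *-identity = *ₚ-identityˡ , (λ f → ≋-trans (*ₚ-comm f (const 1#)) (*ₚ-identityˡ f))
        ; distrib    = (λ h f g → ≋-trans (*ₚ-comm h (f +ₚ g)) (≋-trans (*ₚ-distribʳ h f g)
                                   (+ₚ-cong (*ₚ-comm f h) (*ₚ-comm g h))))
                     , *ₚ-distribʳ }
      ; *-comm = *ₚ-comm } }

  T*ₚ≋0∷ : ∀ f → T *ₚ f ≋ 0# ∷ f
  T*ₚ≋0∷ f = ≋-trans (0∷-*ₚ (const 1#) f) (∷-cong refl (*ₚ-identityˡ f))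

  const-cong : ∀ {a b} → a ≈ b → const a ≋ const b
  const-cong a≈b = ∷-cong a≈b ≋-refl

  const-0 : const 0# ≋ []
  const-0 = 0∷≋[] ≋-refl

  const-* : ∀ a b → const a *ₚ const b ≋ const (a * b)
  const-* a b = mk≋ λ { zero → +-identityʳ _ ; (suc i) → refl }

  coeff-Tpow*ₚ : ∀ n g i → coeff (Tpow n *ₚ g) (n ℕ.+ i) ≈ coeff g i
  coeff-Tpow*ₚ zero    g i = coeff-≈ (*ₚ-identityˡ g) i
  coeff-Tpow*ₚ (suc n) g i = trans (coeff-≈ (0∷-*ₚ (Tpow n) g) (suc (n ℕ.+ i))) (coeff-Tpow*ₚ n g i)

  length≤⇒coeff≈0 : ∀ g {i} → length g ≤ i → coeff g i ≈ 0#
  length≤⇒coeff≈0 []                _       = refl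
  length≤⇒coeff≈0 (a ∷ g) {suc i} (s≤s g≤i) = length≤⇒coeff≈0 g g≤i

  coeff₀-Tpow*ₚ : ∀ n g → coeff (Tpow (suc n) *ₚ g) 0 ≈ 0#
  coeff₀-Tpow*ₚ n g = coeff-≈ (0∷-*ₚ (Tpow n) g) 0

module Congruence {c ℓ} (K : Field c ℓ) (M : FieldTheory.Poly K) where
  open FieldTheory K using (Poly; _≡0mod_; const; T; Tpow; _^ᶠ_)
  open PolynomialRing K using (_≋_; mk≋; coeff-≈; K[T]; T*ₚ≋0∷; const-*; const-0)
  open import Algebra.Properties.Semiring.Mult (Field.semiring K) using () renaming (_×_ to _×ᴷ_)
  open CommutativeRing K[T]
  open import Algebra.Properties.Ring ring using (-‿distribˡ-*)
  open import Algebra.Properties.AbelianGroup +-abelianGroup using (⁻¹-∙-comm)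
  open import Data.Maybe using (nothing)
  open import Data.Product using (_,_)
  open import Function.Bundles using (_⇔_; mk⇔)
  open import Level using (_⊔_)
  open import Tactic.RingSolver.Core.AlmostCommutativeRing using (fromCommutativeRing)
  open import Tactic.RingSolver.NonReflective (fromCommutativeRing K[T] (λ _ → nothing))
    using (solve; _⊜_; _⊕_; _⊗_)
  open import Relation.Binary.Reasoning.Setoid setoid

  -- Congruence modulo M, phrased without subtraction so that its laws need little ring algebra.
  infix 4 _∼_
  record _∼_ (f g : Poly) : Set (c ⊔ ℓ) where
    constructor mk∼
    field
      quotient : Poly
      f≈g+qM   : f ≈ g + quotient * M

  ≋⇒∼ : ∀ {f g} → f ≋ g → f ∼ g
  ≋⇒∼ {f} {g} f≋g = mk∼ 0# (trans f≋g (sym (+-identityʳ g)))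

  ∼-refl : ∀ {f} → f ∼ f
  ∼-refl = ≋⇒∼ refl

  ∼-sym : ∀ {f g} → f ∼ g → g ∼ f
  ∼-sym {f} {g} (mk∼ h f≈g+hM) = mk∼ (- h) (begin
    g                      ≈⟨ +-identityʳ g ⟨
    g + 0#                 ≈⟨ +-congˡ (-‿inverseʳ (h * M)) ⟨
    g + (h * M - h * M)    ≈⟨ +-assoc g (h * M) _ ⟨
    (g + h * M) - h * M    ≈⟨ +-cong f≈g+hM (sym (-‿distribˡ-* h M)) ⟨
    f + - h * M            ∎)

  ∼-trans : ∀ {f g k} → f ∼ g → g ∼ k → f ∼ k
  ∼-trans {f} {g} {k} (mk∼ h f≈g+hM) (mk∼ h′ g≈k+h′M) = mk∼ (h′ + h) (begin
    f                      ≈⟨ f≈g+hM ⟩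
    g + h * M              ≈⟨ +-congʳ g≈k+h′M ⟩
    (k + h′ * M) + h * M   ≈⟨ solve 4 (λ k h′ M h → ((k ⊕ h′ ⊗ M) ⊕ h ⊗ M) ⊜ (k ⊕ (h′ ⊕ h) ⊗ M)) refl k h′ M h ⟩
    k + (h′ + h) * M       ∎)

  ∼-+-cong : ∀ {f f′ g g′} → f ∼ g → f′ ∼ g′ → f + f′ ∼ g + g′
  ∼-+-cong {f} {f′} {g} {g′} (mk∼ h f≈g+hM) (mk∼ h′ f′≈g′+h′M) = mk∼ (h + h′) (begin
    f + f′                         ≈⟨ +-cong f≈g+hM f′≈g′+h′M ⟩
    (g + h * M) + (g′ + h′ * M)    ≈⟨ solve 5 (λ g h g′ h′ M → ((g ⊕ h ⊗ M) ⊕ (g′ ⊕ h′ ⊗ M)) ⊜ ((g ⊕ g′) ⊕ (h ⊕ h′) ⊗ M))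
                                              refl g h g′ h′ M ⟩
    (g + g′) + (h + h′) * M        ∎)

  ∼-*-cong : ∀ {f f′ g g′} → f ∼ g → f′ ∼ g′ → f * f′ ∼ g * g′
  ∼-*-cong {f} {f′} {g} {g′} (mk∼ h f≈g+hM) (mk∼ h′ f′≈g′+h′M) = mk∼ (g * h′ + h * f′) (begin
    f * f′                               ≈⟨ *-congʳ f≈g+hM ⟩
    (g + h * M) * f′                     ≈⟨ distribʳ f′ g (h * M) ⟩
    g * f′ + h * M * f′                  ≈⟨ +-cong (*-congˡ {g} f′≈g′+h′M) (refl {h * M * f′}) ⟩
    g * (g′ + h′ * M) + h * M * f′       ≈⟨ +-cong (distribˡ g g′ (h′ * M)) (refl {h * M * f′}) ⟩
    (g * g′ + g * (h′ * M)) + h * M * f′ ≈⟨ +-assoc (g * g′) (g * (h′ * M)) (h * M * f′) ⟩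
    g * g′ + (g * (h′ * M) + h * M * f′) ≈⟨ +-cong (refl {g * g′}) (+-cong (*-assoc g h′ M) M-last) ⟨
    g * g′ + (g * h′ * M + h * f′ * M)   ≈⟨ +-cong (refl {g * g′}) (distribʳ M (g * h′) (h * f′)) ⟨
    g * g′ + (g * h′ + h * f′) * M       ∎)
    where
    M-last : h * f′ * M ≈ h * M * f′
    M-last = trans (*-assoc h f′ M) (trans (*-congˡ {h} (*-comm f′ M)) (sym (*-assoc h M f′)))

  ∼--‿cong : ∀ {f g} → f ∼ g → - f ∼ - g
  ∼--‿cong {f} {g} (mk∼ h f≈g+hM) = mk∼ (- h) (begin
    - f                ≈⟨ -‿cong f≈g+hM ⟩
    - (g + h * M)      ≈⟨ ⁻¹-∙-comm g (h * M) ⟨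
    - g + - (h * M)    ≈⟨ +-congˡ (-‿distribˡ-* h M) ⟩
    - g + - h * M      ∎)

  M∼0 : M ∼ 0#
  M∼0 = mk∼ 1# (sym (*-identityˡ M))

  ≡0mod⇔∼0 : ∀ f → f ≡0mod M ⇔ f ∼ 0#
  ≡0mod⇔∼0 f = mk⇔ (λ { (h , f≈hM) → mk∼ h (mk≋ f≈hM) })
                   (λ { (mk∼ h f≈hM) → h , coeff-≈ f≈hM })

  K[T]/M : CommutativeRing c (c ⊔ ℓ)
  K[T]/M = record
    { Carrier = Poly ; _≈_ = _∼_ ; _+_ = _+_ ; _*_ = _*_ ; -_ = -_ ; 0# = 0# ; 1# = 1#
    ; isCommutativeRing = record
      { isRing = record
        { +-isAbelianGroup = record
          { isGroup = record
            { isMonoid = record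
              { isSemigroup = record
                { isMagma = record
                  { isEquivalence = record { refl = ∼-refl ; sym = ∼-sym ; trans = ∼-trans }
                  ; ∙-cong = ∼-+-cong }
                ; assoc = λ f g h → ≋⇒∼ (+-assoc f g h) }
              ; identity = (λ f → ≋⇒∼ (+-identityˡ f)) , (λ f → ≋⇒∼ (+-identityʳ f)) }
            ; inverse = (λ f → ≋⇒∼ (-‿inverseˡ f)) , (λ f → ≋⇒∼ (-‿inverseʳ f))
            ; ⁻¹-cong = ∼--‿cong }
          ; comm = λ f g → ≋⇒∼ (+-comm f g) }
        ; *-cong     = ∼-*-cong
        ; *-assoc    = λ f g h → ≋⇒∼ (*-assoc f g h)
        ; *-identity = (λ f → ≋⇒∼ (*-identityˡ f)) , (λ f → ≋⇒∼ (*-identityʳ f))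
        ; distrib    = (λ f g h → ≋⇒∼ (distribˡ f g h)) , (λ f g h → ≋⇒∼ (distribʳ f g h)) }
      ; *-comm = λ f g → ≋⇒∼ (*-comm f g) } }

  open import Algebra.Properties.Semiring.Exp (CommutativeRing.semiring K[T]/M) using (_^_)
  open import Algebra.Properties.Semiring.Mult (CommutativeRing.semiring K[T]/M) using (_×_)

  Tpow∼T^ : ∀ n → Tpow n ∼ T ^ n
  Tpow∼T^ zero    = ∼-refl
  Tpow∼T^ (suc n) = ∼-trans (≋⇒∼ (sym (T*ₚ≋0∷ (Tpow n)))) (∼-*-cong {T} {Tpow n} ∼-refl (Tpow∼T^ n))

  const-^ : ∀ a n → const a ^ n ∼ const (a ^ᶠ n)
  const-^ a zero    = ∼-refl
  const-^ a (suc n) = ∼-trans (∼-*-cong {const a} {const a ^ n} ∼-refl (const-^ a n)) (≋⇒∼ (const-* a (a ^ᶠ n)))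

  const-× : ∀ n a → n × const a ∼ const (n ×ᴷ a)
  const-× zero    a = ≋⇒∼ (sym const-0)
  const-× (suc n) a = ∼-+-cong {const a} {n × const a} ∼-refl (const-× n a)

module Traces {c ℓ} (K : Field c ℓ) where
  open FieldTheory K hiding (zero)
  open import Algebra.Properties.Semiring.Exp semiring using (_^_; ^-congˡ; ^-assocʳ)
  open import Function.Bundles using (_⇔_; mk⇔)
  open import Relation.Binary.Reasoning.Setoid setoid

  ^ᶠ≈^ : ∀ x n → x ^ᶠ n ≈ x ^ n
  ^ᶠ≈^ x zero    = refl
  ^ᶠ≈^ x (suc n) = *-congˡ (^ᶠ≈^ x n)

  -- The residue of F_{Q,n} modulo T^Q − T − α (see Reduction.Fpoly∼Fvalue).
  Fvalue : ℕ → Carrier → ℕ → Carrier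
  Fvalue Q α zero    = 1#
  Fvalue Q α (suc i) = sign (suc i) + trace Q (suc i) α * Fvalue Q α i

  module _ {Q s α} (α∈F[Q^s] : InF (Q ℕ.^ s) α) where

    α^[Q^s]^m≈α : ∀ m → α ^ ((Q ℕ.^ s) ℕ.^ m) ≈ α
    α^[Q^s]^m≈α zero    = *-identityʳ α
    α^[Q^s]^m≈α (suc m) = begin
      α ^ (Q ℕ.^ s ℕ.* (Q ℕ.^ s) ℕ.^ m)  ≈⟨ ^-assocʳ α (Q ℕ.^ s) ((Q ℕ.^ s) ℕ.^ m) ⟨
      (α ^ (Q ℕ.^ s)) ^ ((Q ℕ.^ s) ℕ.^ m) ≈⟨ ^-congˡ ((Q ℕ.^ s) ℕ.^ m) (trans (sym (^ᶠ≈^ α (Q ℕ.^ s))) α∈F[Q^s]) ⟩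
      α ^ ((Q ℕ.^ s) ℕ.^ m)              ≈⟨ α^[Q^s]^m≈α m ⟩
      α                                  ∎

  module _ {Q s α} (α∈F[Q^s] : InF (Q ℕ.^ s) α) (k : ℕ) where

    α^[Q^[1+sk]]^i≈α^Q^i : ∀ i → α ^ ((Q ℕ.^ (1 ℕ.+ s ℕ.* k)) ℕ.^ i) ≈ α ^ (Q ℕ.^ i)
    α^[Q^[1+sk]]^i≈α^Q^i i = begin
      α ^ ((Q ℕ.^ (1 ℕ.+ s ℕ.* k)) ℕ.^ i)           ≡⟨ ≡.cong (α ^_) ([Q^[1+sk]]^i≡[Q^s]^[ki]*Q^i Q s k i) ⟩
      α ^ ((Q ℕ.^ s) ℕ.^ (k ℕ.* i) ℕ.* Q ℕ.^ i)    ≈⟨ ^-assocʳ α ((Q ℕ.^ s) ℕ.^ (k ℕ.* i)) (Q ℕ.^ i) ⟨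
      (α ^ ((Q ℕ.^ s) ℕ.^ (k ℕ.* i))) ^ (Q ℕ.^ i)  ≈⟨ ^-congˡ (Q ℕ.^ i) (α^[Q^s]^m≈α {Q} {s} α∈F[Q^s] (k ℕ.* i)) ⟩
      α ^ (Q ℕ.^ i)                                ∎

    α^ᶠ[Q^[1+sk]]^i≈α^ᶠQ^i : ∀ i → α ^ᶠ ((Q ℕ.^ (1 ℕ.+ s ℕ.* k)) ℕ.^ i) ≈ α ^ᶠ (Q ℕ.^ i)
    α^ᶠ[Q^[1+sk]]^i≈α^ᶠQ^i i = trans (^ᶠ≈^ α ((Q ℕ.^ (1 ℕ.+ s ℕ.* k)) ℕ.^ i))
                              (trans (α^[Q^[1+sk]]^i≈α^Q^i i) (sym (^ᶠ≈^ α (Q ℕ.^ i))))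

    trace-Q^[1+sk] : ∀ n → trace (Q ℕ.^ (1 ℕ.+ s ℕ.* k)) n α ≈ trace Q n α
    trace-Q^[1+sk] zero    = refl
    trace-Q^[1+sk] (suc n) = +-cong (trace-Q^[1+sk] n) (α^ᶠ[Q^[1+sk]]^i≈α^ᶠQ^i n)

    Fvalue-Q^[1+sk] : ∀ n → Fvalue (Q ℕ.^ (1 ℕ.+ s ℕ.* k)) α n ≈ Fvalue Q α n
    Fvalue-Q^[1+sk] zero    = refl
    Fvalue-Q^[1+sk] (suc n) = +-congˡ (*-cong (trace-Q^[1+sk] (suc n)) (Fvalue-Q^[1+sk] n))

    InF-Q^[1+sk]^i⇔InF-Q^i : ∀ i → InF ((Q ℕ.^ (1 ℕ.+ s ℕ.* k)) ℕ.^ i) α ⇔ InF (Q ℕ.^ i) α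
    InF-Q^[1+sk]^i⇔InF-Q^i i = mk⇔ (trans (sym (α^ᶠ[Q^[1+sk]]^i≈α^ᶠQ^i i)))
                                   (trans (α^ᶠ[Q^[1+sk]]^i≈α^ᶠQ^i i))

module Modulus {c ℓ} (K : Field c ℓ) where
  open FieldTheory K hiding (zero)
  open PolynomialRing K
  open import Algebra.Properties.AbelianGroup +-abelianGroup using (⁻¹-∙-comm; x∙y⁻¹≈ε⇒x≈y)
  open import Algebra.Properties.Ring (CommutativeRing.ring K[T]) using (x[y-z]≈xy-xz)
  open import Data.List using (length)
  open import Data.Product using (_,_)
  open import Relation.Binary.Reasoning.Setoid setoid

  *ₚ-const : ∀ g a → g *ₚ const a ≋ scale a g
  *ₚ-const g a = ≋-trans (*ₚ-comm g (const a)) (≋-trans (+ₚ-cong ≋-refl (0∷≋[] ≋-refl)) (+ₚ-identityʳ _))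

  coeff-*ₚ-modulus : ∀ Q α g j →
    coeff (g *ₚ modulus Q α) j ≈ (coeff (Tpow Q *ₚ g) j - coeff (T *ₚ g) j) - α * coeff g j
  coeff-*ₚ-modulus Q α g j = begin
    coeff (g *ₚ modulus Q α) j
      ≈⟨ coeff-≈ (≋-trans (x[y-z]≈xy-xz g (Tpow Q -ₚ T) (const α))
                          (+ₚ-cong (x[y-z]≈xy-xz g (Tpow Q) T) ≋-refl)) j ⟩
    coeff (((g *ₚ Tpow Q) -ₚ (g *ₚ T)) -ₚ (g *ₚ const α)) j
      ≈⟨ coeff-+ₚ ((g *ₚ Tpow Q) -ₚ (g *ₚ T)) (negₚ (g *ₚ const α)) j ⟩
    coeff ((g *ₚ Tpow Q) -ₚ (g *ₚ T)) j + coeff (negₚ (g *ₚ const α)) j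
      ≈⟨ +-cong (coeff-+ₚ (g *ₚ Tpow Q) (negₚ (g *ₚ T)) j) (coeff-negₚ (g *ₚ const α) j) ⟩
    (coeff (g *ₚ Tpow Q) j + coeff (negₚ (g *ₚ T)) j) - coeff (g *ₚ const α) j
      ≈⟨ +-cong (+-cong (coeff-≈ (*ₚ-comm g (Tpow Q)) j)
                        (trans (coeff-negₚ (g *ₚ T) j) (-‿cong (coeff-≈ (*ₚ-comm g T) j))))
                (-‿cong (trans (coeff-≈ (*ₚ-const g α) j) (coeff-scale α g j))) ⟩
    (coeff (Tpow Q *ₚ g) j - coeff (T *ₚ g) j) - α * coeff g j ∎

  x-y-z≈0⇒x≈y+z : ∀ {x y z} → (x - y) - z ≈ 0# → x ≈ y + z
  x-y-z≈0⇒x≈y+z {x} {y} {z} x-y-z≈0 = x∙y⁻¹≈ε⇒x≈y x (y + z) (begin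
    x - (y + z)     ≈⟨ +-congˡ (⁻¹-∙-comm y z) ⟨
    x + (- y - z)   ≈⟨ +-assoc x (- y) (- z) ⟨
    (x - y) - z     ≈⟨ x-y-z≈0 ⟩
    0#              ∎)

  -- Comparing coefficients of a = g M in degrees ≥ Q gives g_i = g_{Q−1+i} + α g_{Q+i}, so all
  -- coefficients of g vanish by downward induction, and then a = −α g_0 = 0.
  const≡0mod-modulus⇒≈0 : ∀ {Q α a} → 1 < Q → const a ≡0mod modulus Q α → a ≈ 0#
  const≡0mod-modulus⇒≈0 {suc zero}      (s≤s ())
  const≡0mod-modulus⇒≈0 {suc (suc Q′)} {α} {a} _ (g , a≈gM) = begin
    a                                                        ≈⟨ a≈gM 0 ⟩
    coeff (g *ₚ modulus Q α) 0                               ≈⟨ coeff-*ₚ-modulus Q α g 0 ⟩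
    (coeff (Tpow Q *ₚ g) 0 - coeff (T *ₚ g) 0) - α * coeff g 0
      ≈⟨ +-cong (+-cong (coeff₀-Tpow*ₚ (suc Q′) g) (-‿cong (coeff₀-Tpow*ₚ 0 g)))
                (-‿cong (trans (*-congˡ (coeff-vanishes (length g) 0 (ℕ.m≤m+n (length g) 0))) (zeroʳ α))) ⟩
    (0# - 0#) - 0#                                           ≈⟨ +-congʳ (-‿inverseʳ 0#) ⟩
    0# - 0#                                                  ≈⟨ -‿inverseʳ 0# ⟩
    0#                                                       ∎
    where
    Q : ℕ
    Q = suc (suc Q′)

    recurrence : ∀ i → coeff g i ≈ coeff g (suc Q′ ℕ.+ i) + α * coeff g (Q ℕ.+ i)
    recurrence i = x-y-z≈0⇒x≈y+z (begin
      (coeff g i - coeff g (suc Q′ ℕ.+ i)) - α * coeff g (Q ℕ.+ i)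
        ≈⟨ +-congʳ (+-cong (coeff-Tpow*ₚ Q g i) (-‿cong (coeff-Tpow*ₚ 1 g (suc Q′ ℕ.+ i)))) ⟨
      (coeff (Tpow Q *ₚ g) (Q ℕ.+ i) - coeff (T *ₚ g) (Q ℕ.+ i)) - α * coeff g (Q ℕ.+ i)
        ≈⟨ coeff-*ₚ-modulus Q α g (Q ℕ.+ i) ⟨
      coeff (g *ₚ modulus Q α) (Q ℕ.+ i)                     ≈⟨ a≈gM (Q ℕ.+ i) ⟨
      0#                                                     ∎)

    coeff-vanishes : ∀ t i → length g ≤ t ℕ.+ i → coeff g i ≈ 0#
    coeff-vanishes zero    i len≤i   = length≤⇒coeff≈0 g len≤i
    coeff-vanishes (suc t) i len≤t+i = begin
      coeff g i                                        ≈⟨ recurrence i ⟩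
      coeff g (suc Q′ ℕ.+ i) + α * coeff g (Q ℕ.+ i)
        ≈⟨ +-cong (coeff-vanishes t _ (ℕ.≤-trans len≤t+i (1+t+i≤t+[1+j+i] t i Q′)))
                  (*-congˡ (coeff-vanishes t _ (ℕ.≤-trans len≤t+i (1+t+i≤t+[1+j+i] t i (suc Q′))))) ⟩
      0# + α * 0#                                      ≈⟨ +-identityˡ _ ⟩
      α * 0#                                           ≈⟨ zeroʳ α ⟩
      0#                                               ∎

module Reduction {c ℓ} (K : Field c ℓ) {p} (p-prime : Prime p) (p×1≈0 : HasCharacteristic K p)
                 {Q} (Q-power : IsPowerOf Q p) (α : Field.Carrier K) where
  open Field K using (_≈_) renaming (1# to 1ᴷ; 0# to 0ᴷ)
  open FieldTheory K using (const; T; Tpow; modulus; bracket; Fpoly; trace; sign; _≡0mod_; _^ᶠ_)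
  open PolynomialRing K
  open Traces K using (Fvalue)
  open Modulus K using (const≡0mod-modulus⇒≈0)
  open Congruence K (modulus Q α)
    using (_∼_; ≋⇒∼; ∼-trans; M∼0; ≡0mod⇔∼0; K[T]/M; Tpow∼T^; const-^; const-×)
  module R = CommutativeRing K[T]/M
  open R using (_+_; _-_; _*_; -_; 0#; refl; sym; trans; +-cong; +-congˡ; +-congʳ; +-assoc; +-identityˡ; +-identityʳ
                 ; -‿inverseˡ; *-cong; setoid)
  open import Algebra.Properties.Semiring.Exp R.semiring using (_^_; ^-assocʳ; ^-congˡ; ^-congʳ)
  open import Algebra.Properties.Semiring.Mult R.semiring using (_×_)
  open Frobenius R.commutativeSemiring using (^p^n-distrib-+)
  open import Algebra.Properties.AbelianGroup R.+-abelianGroup using (⁻¹-∙-comm; xyx⁻¹≈y)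
  open import Data.Product using (proj₁; proj₂)
  open import Function.Bundles using (_⇔_; mk⇔; Equivalence)
  open import Function.Construct.Composition using (_⇔-∘_)
  open import Relation.Binary.Reasoning.Setoid setoid

  private
    e : ℕ
    e = proj₁ Q-power

    Q^i≡p^[ei] : ∀ i → Q ℕ.^ i ≡ p ℕ.^ (e ℕ.* i)
    Q^i≡p^[ei] i = ≡.trans (≡.cong (ℕ._^ i) (proj₂ (proj₂ Q-power))) (ℕ.^-*-assoc p e i)

    char : p × R.1# ∼ 0#
    char = ∼-trans (const-× p 1ᴷ) (≋⇒∼ (≋-trans (const-cong p×1≈0) const-0))

  frobenius : ∀ i f g → (f + g) ^ (Q ℕ.^ i) ∼ f ^ (Q ℕ.^ i) + g ^ (Q ℕ.^ i)
  frobenius i f g = begin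
    (f + g) ^ (Q ℕ.^ i)                  ≈⟨ ^-congʳ (f + g) (Q^i≡p^[ei] i) ⟩
    (f + g) ^ (p ℕ.^ (e ℕ.* i))          ≈⟨ ^p^n-distrib-+ p-prime char (e ℕ.* i) f g ⟩
    f ^ (p ℕ.^ (e ℕ.* i)) + g ^ (p ℕ.^ (e ℕ.* i))
                                         ≈⟨ +-cong (^-congʳ f (≡.sym (Q^i≡p^[ei] i))) (^-congʳ g (≡.sym (Q^i≡p^[ei] i))) ⟩
    f ^ (Q ℕ.^ i) + g ^ (Q ℕ.^ i)        ∎

  Tpow-Q∼T+α : Tpow Q ∼ T + const α
  Tpow-Q∼T+α = begin
    Tpow Q                                  ≈⟨ +-identityʳ (Tpow Q) ⟨
    Tpow Q + 0#                             ≈⟨ +-congˡ {Tpow Q} (-‿inverseˡ (T + const α)) ⟨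
    Tpow Q + (- (T + const α) + (T + const α)) ≈⟨ +-assoc (Tpow Q) (- (T + const α)) (T + const α) ⟨
    (Tpow Q - (T + const α)) + (T + const α)   ≈⟨ +-congʳ {T + const α} (+-congˡ {Tpow Q} (⁻¹-∙-comm T (const α))) ⟨
    (Tpow Q + (- T - const α)) + (T + const α) ≈⟨ +-congʳ {T + const α} (+-assoc (Tpow Q) (- T) (- const α)) ⟨
    modulus Q α + (T + const α)             ≈⟨ +-congʳ {T + const α} M∼0 ⟩
    0# + (T + const α)                      ≈⟨ +-identityˡ _ ⟩
    T + const α                             ∎

  Tpow-Q^i∼T+trace : ∀ i → Tpow (Q ℕ.^ i) ∼ T + const (trace Q i α)
  Tpow-Q^i∼T+trace zero    = sym (trans (+-congˡ {T} (≋⇒∼ const-0)) (+-identityʳ T))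
  Tpow-Q^i∼T+trace (suc i) = begin
    Tpow (Q ℕ.* Q ℕ.^ i)                           ≈⟨ Tpow∼T^ (Q ℕ.* Q ℕ.^ i) ⟩
    T ^ (Q ℕ.* Q ℕ.^ i)                            ≈⟨ ^-assocʳ T Q (Q ℕ.^ i) ⟨
    (T ^ Q) ^ (Q ℕ.^ i)                            ≈⟨ ^-congˡ (Q ℕ.^ i) (trans (sym (Tpow∼T^ Q)) Tpow-Q∼T+α) ⟩
    (T + const α) ^ (Q ℕ.^ i)                      ≈⟨ frobenius i T (const α) ⟩
    T ^ (Q ℕ.^ i) + const α ^ (Q ℕ.^ i)            ≈⟨ +-cong (trans (sym (Tpow∼T^ (Q ℕ.^ i))) (Tpow-Q^i∼T+trace i))
                                                             (const-^ α (Q ℕ.^ i)) ⟩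
    (T + const (trace Q i α)) + const (α ^ᶠ Q ℕ.^ i) ≈⟨ +-assoc T (const (trace Q i α)) (const (α ^ᶠ Q ℕ.^ i)) ⟩
    T + const (trace Q (suc i) α)                  ∎

  bracket∼trace : ∀ i → bracket Q i ∼ const (trace Q i α)
  bracket∼trace i = begin
    Tpow (Q ℕ.^ i) - T                      ≈⟨ +-congʳ { - T} (Tpow-Q^i∼T+trace i) ⟩
    (T + const (trace Q i α)) - T           ≈⟨ xyx⁻¹≈y T (const (trace Q i α)) ⟩
    const (trace Q i α)                     ∎

  Fpoly∼Fvalue : ∀ n → Fpoly Q n ∼ const (Fvalue Q α n)
  Fpoly∼Fvalue zero    = refl
  Fpoly∼Fvalue (suc n) = begin
    const (sign (suc n)) + bracket Q (suc n) * Fpoly Q n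
      ≈⟨ +-congˡ {const (sign (suc n))} (*-cong (bracket∼trace (suc n)) (Fpoly∼Fvalue n)) ⟩
    const (sign (suc n)) + const (trace Q (suc n) α) * const (Fvalue Q α n)
      ≈⟨ +-congˡ {const (sign (suc n))} (≋⇒∼ (const-* (trace Q (suc n) α) (Fvalue Q α n))) ⟩
    const (Fvalue Q α (suc n)) ∎

  const∼0⇔≈0 : ∀ a → const a ∼ 0# ⇔ a ≈ 0ᴷ
  const∼0⇔≈0 a = mk⇔
    (λ a∼0 → const≡0mod-modulus⇒≈0 (IsPowerOf⇒>1 p-prime Q-power) (Equivalence.from (≡0mod⇔∼0 (const a)) a∼0))
    (λ a≈0 → ≋⇒∼ (≋-trans (const-cong a≈0) const-0))

  Fpoly≡0mod⇔Fvalue≈0 : ∀ n → Fpoly Q n ≡0mod modulus Q α ⇔ Fvalue Q α n ≈ 0ᴷ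
  Fpoly≡0mod⇔Fvalue≈0 n =
    const∼0⇔≈0 (Fvalue Q α n)
      ⇔-∘ (mk⇔ (trans (sym (Fpoly∼Fvalue n))) (trans (Fpoly∼Fvalue n)) ⇔-∘ ≡0mod⇔∼0 (Fpoly Q n))

module _ {c ℓ} (L : Field c ℓ) where
  open FieldTheory L hiding (zero)
  open import Data.Product using (_,_)
  open import Function.Bundles using (_⇔_; mk⇔; Equivalence)
  open Equivalence using (to; from)
  open import Function.Construct.Composition using (_⇔-∘_)
  open import Function.Construct.Symmetry using (⇔-sym)

  InB-cong : ∀ {p Q Q′ s χ α} → (∀ j → InF (Q′ ℕ.^ j) α ⇔ InF (Q ℕ.^ j) α) → trace Q′ s α ≈ trace Q s α →
             Fpoly Q′ (p ℕ.* s ∸ 1) ≡0mod modulus Q′ α ⇔ Fpoly Q (p ℕ.* s ∸ 1) ≡0mod modulus Q α →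
             InB p Q′ s χ α ⇔ InB p Q s χ α
  InB-cong {s = s} InF⇔ trace≈ F⇔ = mk⇔
    (λ (α∈F , (1≤s , α∈F′ , notBelow) , trace≈χ , F≡0) →
       to (InF⇔ s) α∈F , (1≤s , to (InF⇔ s) α∈F′ , λ j 1≤j j<s → notBelow j 1≤j j<s ∘ from (InF⇔ j))
       , trans (sym trace≈) trace≈χ , to F⇔ F≡0)
    (λ (α∈F , (1≤s , α∈F′ , notBelow) , trace≈χ , F≡0) →
       from (InF⇔ s) α∈F , (1≤s , from (InF⇔ s) α∈F′ , λ j 1≤j j<s → notBelow j 1≤j j<s ∘ to (InF⇔ j))
       , trans trace≈ trace≈χ , from F⇔ F≡0)

  module _ {p} (p-prime : Prime p) (p×1≈0 : HasCharacteristic L p)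
           {Q} (Q-power : IsPowerOf Q p) {s α} (α∈F[Q^s] : InF (Q ℕ.^ s) α) (k : ℕ) where
    open Traces L using (Fvalue-Q^[1+sk])

    Fpoly≡0mod-Q^[1+sk]⇔Fpoly≡0mod-Q : ∀ n →
      Fpoly (Q ℕ.^ (1 ℕ.+ s ℕ.* k)) n ≡0mod modulus (Q ℕ.^ (1 ℕ.+ s ℕ.* k)) α ⇔ Fpoly Q n ≡0mod modulus Q α
    Fpoly≡0mod-Q^[1+sk]⇔Fpoly≡0mod-Q n =
      ⇔-sym (Reduction.Fpoly≡0mod⇔Fvalue≈0 L p-prime p×1≈0 Q-power α n)
      ⇔-∘ (mk⇔ (trans (sym (Fvalue-Q^[1+sk] {Q} {s} α∈F[Q^s] k n))) (trans (Fvalue-Q^[1+sk] {Q} {s} α∈F[Q^s] k n))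
           ⇔-∘ Reduction.Fpoly≡0mod⇔Fvalue≈0 L p-prime p×1≈0 (IsPowerOf-^ {m = 1 ℕ.+ s ℕ.* k} Q-power (s≤s z≤n)) α n)

open import Data.Product using (_×_)
open import Function.Bundles using (_⇔_)
open import Relation.Nullary using (¬_)

lemma5p2 : ∀ {c ℓ} (p q : ℕ) → Prime p → IsPowerOf q p
    → (s k : ℕ) → 1 ℕ.≤ s → 1 ℕ.≤ k
    → (L : Field c ℓ) → HasSize L (q ℕ.^ ((1 ℕ.+ s ℕ.* k) ℕ.* s))
    → let open FieldTheory L in
      (α : Carrier) → InF (q ℕ.^ s) α → DegreeOver q s α
    → ((n : ℕ) → 1 ℕ.≤ n →
         (Fpoly q n ≡0mod modulus q α)
           ⇔ (Fpoly (q ℕ.^ (1 ℕ.+ s ℕ.* k)) n ≡0mod modulus (q ℕ.^ (1 ℕ.+ s ℕ.* k)) α))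
      × ((χ : Carrier) → InF q χ → ¬ (χ ≈ 0#) →
         InB p (q ℕ.^ (1 ℕ.+ s ℕ.* k)) s χ α ⇔ InB p q s χ α)
lemma5p2 p q p-prime q-power s k 1≤s _ L finite α α∈F[q^s] _ =
    (λ n _ → ⇔-sym (Fpoly≡0mod⇔ n))
  , (λ χ _ _ → InB-cong L {p} (InF-Q^[1+sk]^i⇔InF-Q^i L {q} {s} α∈F[q^s] k) (trace-Q^[1+sk] L {q} {s} α∈F[q^s] k s)
                          (Fpoly≡0mod⇔ (p ℕ.* s ∸ 1)))
  where
  open FieldTheory L
  open Traces using (InF-Q^[1+sk]^i⇔InF-Q^i; trace-Q^[1+sk])

  p×1≈0 : HasCharacteristic L p
  p×1≈0 = FiniteField.IsPowerOf⇒p×1≈0 L finite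
            (IsPowerOf-^ q-power (ℕ.*-mono-≤ {1} {1 ℕ.+ s ℕ.* k} (s≤s z≤n) 1≤s))

  Fpoly≡0mod⇔ : ∀ n → Fpoly (q ℕ.^ (1 ℕ.+ s ℕ.* k)) n ≡0mod modulus (q ℕ.^ (1 ℕ.+ s ℕ.* k)) α
                      ⇔ Fpoly q n ≡0mod modulus q α
  Fpoly≡0mod⇔ = Fpoly≡0mod-Q^[1+sk]⇔Fpoly≡0mod-Q L p-prime p×1≈0 q-power {s} α∈F[q^s] k
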